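{- Suppose $P$ is a $2$-chain with $n$ elements, where $n\geq 3$. Then $P$ is isomorphic to $\mathcal{Q}(n_1)\mathbin{\square}\cdots\mathbin{\square}\mathcal{Q}(n_s)$ for a unique choice of $n_1,\dots,n_s\geq 3$ with $n_1+\dots+n_s=n+2s-2$.
   Context: All posets are finite; partial orders are written $\preceq$. A poset $(P,\preceq)$ is a $2$-chain if (1) there is a unique way to write $P$ as the union of two chains, and (2) $\preceq$ is maximal subject to (1), i.e. for every proper refinement $\preceq^+$ of $\preceq$ there is more than one way to write $P$ as the union of two $\preceq^+$-chains. A maximal element is supermaximal if it lies above all non-maximal elements; superminimal is defined dually. A $2$-chain with at least $3$ elements has exactly two maximal elements, exactly one supermaximal, and dually two minimal elements, exactly one superminimal. $\mathcal{Q}(m)=\{1,\dots,m\}$ with $i\prec j$ iff $i\leq j-2$. Splice: if $P$ has exactly two maximal elements $p_0,p_1$ with only $p_0$ supermaximal, and $Q$ has exactly two minimal elements $q_0,q_1$ with only $q_0$ superminimal, then $P\mathbin{\square}Q$ is obtained from the disjoint union $P\sqcup Q$ (orders within $P$ and within $Q$ unchanged; for $a\in P$, $b\in Q$: $a\preceq b$ iff $a\preceq p_i$ in $P$ and $q_i\preceq b$ in $Q$ for some $i\in\{0,1\}$; no element of $Q$ lies below an element of $P$) by identifying $p_0$ with $q_0$ and $p_1$ with $q_1$. -}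

module Defs where

open import Data.Nat using (ℕ; zero; suc; _+_; _*_; _∸_; _≤_; _≡ᵇ_; _≤ᵇ_)
open import Data.Bool using (Bool; true; false; not; _∧_; _∨_; T)
open import Data.Fin using (Fin; zero; suc; toℕ; fromℕ; inject₁; splitAt)
open import Data.Sum using (_⊎_; inj₁; inj₂)
open import Data.Product using (Σ; ∃; _×_; _,_)
open import Data.List using (List; []; _∷_; length)
open import Data.Nat.ListAction using (sum)
open import Data.List.NonEmpty using (List⁺; _∷_; toList)
open import Data.List.Relation.Unary.All using (All)
open import Relation.Nullary using (¬_)
open import Relation.Binary.PropositionalEquality using (_≡_)
open import Relation.Binary.Structures using (IsPartialOrder)

-- A (decidable) binary relation on the n-element set Fin n.
-- (On a finite set every relation is decidable, so Bool-valued relations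
-- represent all relations.)
BRel : ℕ → Set
BRel n = Fin n → Fin n → Bool

IsPO : ∀ {n} → BRel n → Set
IsPO R = IsPartialOrder _≡_ (λ a b → T (R a b))

record FinPoset (n : ℕ) : Set where
  field
    rel  : BRel n
    isPO : IsPO rel

Comparable : ∀ {n} → BRel n → Fin n → Fin n → Set
Comparable R a b = T (R a b) ⊎ T (R b a)

-- A way of writing the poset as a (disjoint) union of two chains,
-- encoded as a 2-colouring whose colour classes are chains.
-- The colourings c and (not ∘ c) describe the same way (unordered pair).
ChainColouring : ∀ {n} → BRel n → (Fin n → Bool) → Set
ChainColouring R c = ∀ a b → c a ≡ c b → Comparable R a b

SameWay : ∀ {n} → (Fin n → Bool) → (Fin n → Bool) → Set
SameWay c c' = (∀ i → c' i ≡ c i) ⊎ (∀ i → c' i ≡ not (c i))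

UniqueTwoChainCover : ∀ {n} → BRel n → Set
UniqueTwoChainCover R =
  Σ (Fin _ → Bool) λ c → ChainColouring R c ×
    (∀ c' → ChainColouring R c' → SameWay c c')

SeveralTwoChainCovers : ∀ {n} → BRel n → Set
SeveralTwoChainCovers R =
  Σ (Fin _ → Bool) λ c → Σ (Fin _ → Bool) λ c' →
    ChainColouring R c × ChainColouring R c' × ¬ SameWay c c'

ProperRefinement : ∀ {n} → BRel n → BRel n → Set
ProperRefinement R R' =
  IsPO R' × (∀ a b → T (R a b) → T (R' a b)) ×
  Σ (Fin _) λ a → Σ (Fin _) λ b → T (R' a b) × ¬ T (R a b)

Is2Chain : ∀ {n} → FinPoset n → Set
Is2Chain P = UniqueTwoChainCover R ×
  (∀ R' → ProperRefinement R R' → SeveralTwoChainCovers R')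
  where R = FinPoset.rel P

-- Q(c) on Fin c (0-based labels; shifting by 1 is harmless):
-- i ⪯ j iff i = j or i ≤ j - 2.
Qrel : (c : ℕ) → BRel c
Qrel c i j = (toℕ i ≡ᵇ toℕ j) ∨ (suc (suc (toℕ i)) ≤ᵇ toℕ j)

-- Splice P □ Q, where P lives on Fin a with designated maximal elements
-- p0 (supermaximal) and p1, and Q lives on Fin (2 + b) with minimal
-- elements q0 = zero (superminimal) and q1 = suc zero.  The result lives on
-- Fin (a + b): the first a elements are P (with p0, p1 identified with
-- q0, q1), the remaining b elements are Q ∖ {q0, q1}.
splice : (a b : ℕ) → BRel a → (p0 p1 : Fin a) → BRel (2 + b) → BRel (a + b)
splice a b R p0 p1 S x y with splitAt a x | splitAt a y
... | inj₁ i | inj₁ j = R i j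
... | inj₂ i | inj₂ j = S (suc (suc i)) (suc (suc j))
... | inj₁ i | inj₂ j = (R i p0 ∧ S zero (suc (suc j))) ∨ (R i p1 ∧ S (suc zero) (suc (suc j)))
... | inj₂ i | inj₁ j = false

-- Iterated splice Q(m) □ Q(m₁) □ ⋯ □ Q(mₖ) (associated to the right).
-- For m ≥ 3, Fin (2 + (m ∸ 2)) = Fin m, the maximal elements of Q(m) are
-- m-1 (supermaximal, 0-based index m ∸ 1) and m-2 (0-based m ∸ 2), and the
-- minimal elements of the iterated splice are always 0 and 1 (superminimal 0).
chainSize : ℕ → List ℕ → ℕ
chainSize m []        = m ∸ 2
chainSize m (m' ∷ ms) = (m ∸ 2) + chainSize m' ms

spliceQs : (m : ℕ) (ms : List ℕ) → BRel (2 + chainSize m ms)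
spliceQs m []        = Qrel (2 + (m ∸ 2))
spliceQs m (m' ∷ ms) =
  splice (2 + (m ∸ 2)) (chainSize m' ms) (Qrel (2 + (m ∸ 2)))
         (fromℕ (suc (m ∸ 2))) (inject₁ (fromℕ (m ∸ 2))) (spliceQs m' ms)

SpliceOfQs : (ns : List⁺ ℕ) → BRel (2 + chainSize (List⁺.head ns) (List⁺.tail ns))
SpliceOfQs (m ∷ ms) = spliceQs m ms

record Iso {n k : ℕ} (R : BRel n) (S : BRel k) : Set where
  field
    to       : Fin n → Fin k
    from     : Fin k → Fin n
    from-to  : ∀ x → from (to x) ≡ x
    to-from  : ∀ y → to (from y) ≡ y
    preserve : ∀ x y → R x y ≡ S (to x) (to y)

-- ns = (n₁,…,n_s) is an admissible choice for P: all nᵢ ≥ 3,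
-- n₁ + ⋯ + n_s = n + 2s − 2 (written without truncated subtraction), and
-- P ≅ Q(n₁) □ ⋯ □ Q(n_s).
Decomposition : ∀ {n} → FinPoset n → List⁺ ℕ → Set
Decomposition {n} P ns =
  All (3 ≤_) (toList ns) ×
  (sum (toList ns) + 2 ≡ n + 2 * length (toList ns)) ×
  Iso (FinPoset.rel P) (SpliceOfQs ns)

module Submission where

-- In a 2-chain P, some minimal element z lies below every element except another minimal
-- element w: otherwise putting a minimal element below the up-set of a suitable x would be a
-- proper refinement with the same chain covers, contradicting maximality. Hence P is the cone
-- over the 2-chain P ∖ {z} at its minimal element w. By induction P ∖ {z} ≅ Q(n₁) □ ⋯ □ Q(nₛ),
-- and w is one of its minimal elements 0, 1: the cone at 0 is Q(n₁ + 1) □ ⋯ □ Q(nₛ), the cone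
-- at 1 is Q(3) □ Q(n₁) □ ⋯ □ Q(nₛ). Conversely, in such a splice 0 is the only element below all
-- elements but one, and 1 the only element not above 0, so every isomorphism of splices fixes
-- 0 and 1; removing 0 recovers the shorter sequences, and uniqueness follows by induction.

open import Defs
open import Data.Bool using (Bool; true; false; not; _∧_; _∨_; _xor_; T)
open import Data.Bool.Properties
  using (T-∨; T-≡; T-not-≡; ∨-identityʳ; ¬-not; not-¬; not-injective; not-involutive)
open import Data.Empty using (⊥; ⊥-elim)
open import Data.Fin using (Fin; zero; suc; _≟_; punchIn; punchOut; splitAt; opposite)
open import Data.Fin.Induction using (po-wellFounded)
open import Data.Fin.Properties
  using (any?; injective⇒≤; punchIn-injective; punchInᵢ≢i; punchIn-punchOut; punchOut-punchIn;
         punchOut-cong; punchOut-injective; suc-injective; opposite-involutive)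
open import Data.List using (List; []; _∷_; length)
open import Data.List.NonEmpty using (List⁺; _∷_; toList)
open import Data.List.Relation.Unary.All using (All; []; _∷_)
open import Data.Nat using (ℕ; zero; suc; _+_; _*_; _∸_; _≤_; s≤s; z≤n)
open import Data.Nat.ListAction using (sum)
import Data.Nat.Properties as ℕ
open import Algebra.Properties.CommutativeSemigroup ℕ.+-commutativeSemigroup using ()
  renaming (interchange to +-interchange)
open import Data.Product using (Σ; ∃; _×_; _,_; proj₁; proj₂)
open import Data.Sum using (_⊎_; inj₁; inj₂; [_,_]′; swap)
import Data.Sum as Sum
open import Function using (_∘_; Equivalence; mk⇔)
open import Induction.WellFounded using (Acc; acc)
open import Relation.Binary.PropositionalEquality
  using (_≡_; _≢_; _≗_; refl; sym; trans; cong; cong₂; subst; isEquivalence; module ≡-Reasoning)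
open import Relation.Binary.Structures using (IsPartialOrder)
open import Relation.Nullary using (¬_; Dec; yes; no; does)
open import Relation.Nullary.Decidable
  using (T?; ¬?; _×-dec_; _⊎-dec_; ⌊_⌋; decidable-stable; dec-true; dec-false; does-⇔; isYes≗does;
         fromWitness; fromWitnessFalse; toWitnessFalse)

∨-introˡ : ∀ {x} y → T x → T (x ∨ y)
∨-introˡ _ = Equivalence.from T-∨ ∘ inj₁

∨-introʳ : ∀ x {y} → T y → T (x ∨ y)
∨-introʳ _ = Equivalence.from T-∨ ∘ inj₂

T⇒≡true : ∀ {b} → T b → b ≡ true
T⇒≡true = Equivalence.to T-≡

¬T⇒≡false : ∀ {b} → ¬ T b → b ≡ false
¬T⇒≡false {false} _  = refl
¬T⇒≡false {true}  ¬t = ⊥-elim (¬t _)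

≡false⇒¬T : ∀ {b} → b ≡ false → ¬ T b
≡false⇒¬T refl ()

mkIsPO : ∀ {n} {R : BRel n} → (∀ x → T (R x x)) →
         (∀ {x y} → T (R x y) → T (R y x) → x ≡ y) →
         (∀ {x y z} → T (R x y) → T (R y z) → T (R x z)) → IsPO R
mkIsPO r a t = record
  { isPreorder = record
    { isEquivalence = isEquivalence
    ; reflexive = λ { refl → r _ } ; trans = t }
  ; antisym = a }

module PartialOrder {n} {R : BRel n} (po : IsPO R) where
  ⊑-refl : ∀ x → T (R x x)
  ⊑-refl x = IsPartialOrder.reflexive po refl

  ⊑-trans : ∀ {x y z} → T (R x y) → T (R y z) → T (R x z)
  ⊑-trans = IsPartialOrder.trans po

  ⊑-antisym : ∀ {x y} → T (R x y) → T (R y x) → x ≡ y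
  ⊑-antisym = IsPartialOrder.antisym po

Minimal : ∀ {n} → BRel n → Fin n → Set
Minimal R m = ∀ y → T (R y m) → y ≡ m

Incomparable : ∀ {n} → BRel n → Fin n → Fin n → Set
Incomparable R a b = ¬ Comparable R a b

comparable? : ∀ {n} (R : BRel n) a b → Dec (Comparable R a b)
comparable? R a b = T? (R a b) ⊎-dec T? (R b a)

module _ {n} {R : BRel n} (po : IsPO R) where
  open PartialOrder po

  minimal-below : ∀ x → ∃ λ m → T (R m x) × Minimal R m
  minimal-below x = go x (po-wellFounded po x)
    where
    go : ∀ x → Acc (λ y x → T (R y x) × y ≢ x) x → ∃ λ m → T (R m x) × Minimal R m
    go x (acc below) with any? (λ y → T? (R y x) ×-dec ¬? (y ≟ x))
    ... | yes (y , y⊑x , y≢x) =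
      let m , m⊑y , m-min = go y (below (y⊑x , y≢x)) in m , ⊑-trans m⊑y y⊑x , m-min
    ... | no nothing-below =
      x , ⊑-refl x , λ y y⊑x → decidable-stable (y ≟ x) (λ y≢x → nothing-below (y , y⊑x , y≢x))

minimal-incomparable : ∀ {n} {R : BRel n} {a b} → Minimal R a → Minimal R b → a ≢ b →
                       Incomparable R a b
minimal-incomparable a-min b-min a≢b = [ a≢b ∘ b-min _ , a≢b ∘ sym ∘ a-min _ ]′

Is2ChainRel : ∀ {n} → BRel n → Set
Is2ChainRel R = UniqueTwoChainCover R × (∀ R′ → ProperRefinement R R′ → SeveralTwoChainCovers R′)

module _ {n} {R : BRel n} {c : Fin n → Bool} (col : ChainColouring R c) where

  colour-incomparable : ∀ {a b} → Incomparable R a b → c a ≡ not (c b)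
  colour-incomparable a∥b = ¬-not (a∥b ∘ col _ _)

  no-incomparable-triple : ∀ {x y z} → Incomparable R x y → Incomparable R x z →
                           Incomparable R y z → ⊥
  no-incomparable-triple x∥y x∥z y∥z =
    y∥z (col _ _ (not-injective (trans (sym (colour-incomparable x∥y)) (colour-incomparable x∥z))))

  above-one-of-two-minimal : IsPO R → ∀ {a b} → Minimal R a → Minimal R b → a ≢ b →
                             ∀ t → T (R a t) ⊎ T (R b t)
  above-one-of-two-minimal po {a} {b} a-min b-min a≢b t with minimal-below po t
  ... | m , m⊑t , m-min with m ≟ a | m ≟ b
  ... | yes refl | _        = inj₁ m⊑t
  ... | no _     | yes refl = inj₂ m⊑t
  ... | no m≢a   | no m≢b   = ⊥-elim (no-incomparable-triple
        (minimal-incomparable m-min a-min m≢a) (minimal-incomparable m-min b-min m≢b)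
        (minimal-incomparable a-min b-min a≢b))

SameWay-sym : ∀ {n} {c c' : Fin n → Bool} → SameWay c c' → SameWay c' c
SameWay-sym (inj₁ c'≗c)    = inj₁ (sym ∘ c'≗c)
SameWay-sym {c = c} (inj₂ c'≗¬c) =
  inj₂ λ i → trans (sym (not-involutive (c i))) (cong not (sym (c'≗¬c i)))

SameWay-trans : ∀ {n} {c c' c'' : Fin n → Bool} → SameWay c c' → SameWay c' c'' → SameWay c c''
SameWay-trans (inj₁ e) (inj₁ e') = inj₁ λ i → trans (e' i) (e i)
SameWay-trans (inj₁ e) (inj₂ e') = inj₂ λ i → trans (e' i) (cong not (e i))
SameWay-trans (inj₂ e) (inj₁ e') = inj₂ λ i → trans (e' i) (e i)
SameWay-trans {c = c} (inj₂ e) (inj₂ e') =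
  inj₁ λ i → trans (e' i) (trans (cong not (e i)) (not-involutive (c i)))

unique⇒¬several : ∀ {n} {R : BRel n} → UniqueTwoChainCover R → ¬ SeveralTwoChainCovers R
unique⇒¬several (c , _ , unique) (c₁ , c₂ , col₁ , col₂ , ¬same) =
  ¬same (SameWay-trans (SameWay-sym (unique c₁ col₁)) (unique c₂ col₂))

recolour : ∀ {n} → (Fin n → Bool) → Fin n → Fin n → Bool
recolour c a x = does (x ≟ a) xor c x

recolour-self : ∀ {n} (c : Fin n → Bool) a → recolour c a a ≡ not (c a)
recolour-self c a rewrite dec-true (a ≟ a) refl = refl

recolour-other : ∀ {n} (c : Fin n → Bool) {a x} → x ≢ a → recolour c a x ≡ c x
recolour-other c {a} {x} x≢a rewrite dec-false (x ≟ a) x≢a = refl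

comparable-to-all⇒several : ∀ {n} {R : BRel n} {c} → IsPO R → ChainColouring R c →
  ∀ {a e} → (∀ x → Comparable R a x) → e ≢ a → SeveralTwoChainCovers R
comparable-to-all⇒several {R = R} {c} po col {a} {e} a~all e≢a =
  c , recolour c a , col , col′ , ¬same
  where
  open PartialOrder po
  col′ : ChainColouring R (recolour c a)
  col′ x y eq with x ≟ a | y ≟ a
  ... | yes refl | yes refl = inj₁ (⊑-refl x)
  ... | yes refl | no _     = a~all y
  ... | no _     | yes refl = swap (a~all x)
  ... | no _     | no _     = col x y eq
  ¬same : ¬ SameWay c (recolour c a)
  ¬same (inj₁ same) = not-¬ refl (sym (trans (sym (recolour-self c a)) (same a)))
  ¬same (inj₂ same) = not-¬ refl (trans (sym (recolour-other c e≢a)) (same e))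

refinement-colouring : ∀ {n} {R R′ : BRel n} → (∀ x y → T (R x y) → T (R′ x y)) →
                       ∀ {c} → ChainColouring R c → ChainColouring R′ c
refinement-colouring refines col x y same = Sum.map (refines x y) (refines y x) (col x y same)

-- The superminimal element

placeBelow : ∀ {n} → BRel n → Fin n → Fin n → BRel n
placeBelow R a x u v = R u v ∨ (does (u ≟ a) ∧ R x v)

module _ {n} (R : BRel n) (a x : Fin n) where

  placeBelow-cases : ∀ {u v} → T (placeBelow R a x u v) → T (R u v) ⊎ (u ≡ a × T (R x v))
  placeBelow-cases {u} {v} p with Equivalence.to T-∨ p
  ... | inj₁ u⊑v = inj₁ u⊑v
  ... | inj₂ q with u ≟ a
  ...   | yes u≡a = inj₂ (u≡a , q)

  placeBelow-extends : ∀ {u v} → T (R u v) → T (placeBelow R a x u v)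
  placeBelow-extends = ∨-introˡ _

  placeBelow-new : ∀ {v} → T (R x v) → T (placeBelow R a x a v)
  placeBelow-new {v} x⊑v rewrite dec-true (a ≟ a) refl = ∨-introʳ (R a v) x⊑v

  placeBelow-absent : ∀ {u v} → ¬ T (R u v) → (u ≡ a → ¬ T (R x v)) → ¬ T (placeBelow R a x u v)
  placeBelow-absent u⋢v new-absent p with placeBelow-cases p
  ... | inj₁ u⊑v          = u⋢v u⊑v
  ... | inj₂ (u≡a , x⊑v)  = new-absent u≡a x⊑v

  placeBelow-isPO : IsPO R → Minimal R a → IsPO (placeBelow R a x)
  placeBelow-isPO po a-min = mkIsPO (λ u → placeBelow-extends (⊑-refl u)) antisym′ trans′
    where
    open PartialOrder po
    antisym′ : ∀ {u v} → T (placeBelow R a x u v) → T (placeBelow R a x v u) → u ≡ v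
    antisym′ {u} {v} p q with placeBelow-cases p | placeBelow-cases q
    ... | inj₁ u⊑v        | inj₁ v⊑u        = ⊑-antisym u⊑v v⊑u
    ... | inj₁ u⊑v        | inj₂ (refl , _)  = a-min u u⊑v
    ... | inj₂ (refl , _) | inj₁ v⊑u        = sym (a-min v v⊑u)
    ... | inj₂ (refl , _) | inj₂ (refl , _)  = refl
    trans′ : ∀ {u v t} → T (placeBelow R a x u v) → T (placeBelow R a x v t) → T (placeBelow R a x u t)
    trans′ {u} p q with placeBelow-cases p | placeBelow-cases q
    ... | inj₁ u⊑v         | inj₁ v⊑t         = placeBelow-extends (⊑-trans u⊑v v⊑t)
    ... | inj₁ u⊑v         | inj₂ (refl , x⊑t) rewrite a-min u u⊑v = placeBelow-new x⊑t
    ... | inj₂ (refl , x⊑v) | inj₁ v⊑t        = placeBelow-new (⊑-trans x⊑v v⊑t)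
    ... | inj₂ (refl , _)  | inj₂ (_ , x⊑t)   = placeBelow-new x⊑t

  placeBelow-proper : IsPO R → Minimal R a → ¬ T (R a x) → ProperRefinement R (placeBelow R a x)
  placeBelow-proper po a-min a⋢x =
    placeBelow-isPO po a-min , (λ _ _ → placeBelow-extends) ,
    a , x , placeBelow-new (PartialOrder.⊑-refl po x) , a⋢x

module _ {n} {R : BRel n} (po : IsPO R) {a b x y : Fin n}
         (b-min : Minimal R b) (a∥b : Incomparable R a b) (x≢b : x ≢ b) (b⊑x : T (R b x))
         (a⊑y : T (R a y)) (b⋢y : ¬ T (R b y)) (y≢a : y ≢ a) where
  open PartialOrder po

  -- A colouring by R′-chains, R′ = placeBelow R a x, alternates along the R′-incomparable
  -- pairs a∥b, b∥y, y∥v, so a new edge a ⊑′ v (where x ⊑ v) always joins different colours.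
  placeBelow-colouring : ∀ {c} → ChainColouring (placeBelow R a x) c → ChainColouring R c
  placeBelow-colouring {c} col′ u v same with comparable? R u v
  ... | yes u~v = u~v
  ... | no u∥v  = ⊥-elim ([ one-way u∥v same , one-way (u∥v ∘ swap) (sym same) ]′ (col′ u v same))
    where
    R′ = placeBelow R a x
    ∥′ : ∀ {u v} → (¬ T (R u v) × (u ≡ a → ¬ T (R x v))) → (¬ T (R v u) × (v ≡ a → ¬ T (R x u))) →
         Incomparable R′ u v
    ∥′ (u⋢v , u⋢′v) (v⋢u , v⋢′u) =
      [ placeBelow-absent R a x u⋢v u⋢′v , placeBelow-absent R a x v⋢u v⋢′u ]′
    a≢b : a ≢ b
    a≢b refl = a∥b (inj₁ (⊑-refl a))
    a∥′b : Incomparable R′ a b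
    a∥′b = ∥′ (a∥b ∘ inj₁ , λ _ x⊑b → x≢b (b-min x x⊑b)) (a∥b ∘ inj₂ , λ b≡a _ → a≢b (sym b≡a))
    b∥′y : Incomparable R′ b y
    b∥′y = ∥′ (b⋢y , λ b≡a _ → a≢b (sym b≡a))
              ((λ y⊑b → b⋢y (subst (λ t → T (R b t)) (sym (b-min y y⊑b)) (⊑-refl b))) ,
               λ y≡a _ → y≢a y≡a)
    y∥′ : ∀ {v} → T (R x v) → Incomparable R a v → Incomparable R′ y v
    y∥′ x⊑v a∥v = ∥′ ((λ y⊑v → a∥v (inj₁ (⊑-trans a⊑y y⊑v))) , λ y≡a _ → y≢a y≡a)
                     ((λ v⊑y → b⋢y (⊑-trans b⊑x (⊑-trans x⊑v v⊑y))) ,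
                      λ _ x⊑y → b⋢y (⊑-trans b⊑x x⊑y))
    crossing : ∀ {v} → T (R x v) → Incomparable R a v → c a ≡ c v → ⊥
    crossing {v} x⊑v a∥v ca≡cv = not-¬ refl (begin
      c v             ≡⟨ sym ca≡cv ⟩
      c a             ≡⟨ colour-incomparable col′ a∥′b ⟩
      not (c b)       ≡⟨ cong not (colour-incomparable col′ b∥′y) ⟩
      not (not (c y)) ≡⟨ not-involutive (c y) ⟩
      c y             ≡⟨ colour-incomparable col′ (y∥′ x⊑v a∥v) ⟩
      not (c v)       ∎)
      where open ≡-Reasoning
    one-way : ∀ {u v} → Incomparable R u v → c u ≡ c v → ¬ T (placeBelow R a x u v)
    one-way u∥v same p with placeBelow-cases R a x p
    ... | inj₁ u⊑v          = u∥v (inj₁ u⊑v)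
    ... | inj₂ (refl , x⊑v) = crossing x⊑v u∥v same

record SuperminimalPair {n} (R : BRel n) (z w : Fin n) : Set where
  field
    z-minimal : Minimal R z
    w-minimal : Minimal R w
    z∥w       : Incomparable R z w
    z-below   : ∀ x → x ≢ w → T (R z x)

module _ {n} {R : BRel n} (po : IsPO R) (2chain : Is2ChainRel R) where
  open PartialOrder po
  private
    unique = proj₁ 2chain
    maximal = proj₂ 2chain
    col = proj₁ (proj₂ unique)

  has-incomparable : ∀ {e} a → e ≢ a → ∃ (Incomparable R a)
  has-incomparable a e≢a with any? (λ x → ¬? (comparable? R a x))
  ... | yes a∥x = a∥x
  ... | no none = ⊥-elim (unique⇒¬several unique (comparable-to-all⇒several po col a~all e≢a))
    where
    a~all : ∀ x → Comparable R a x
    a~all x = decidable-stable (comparable? R a x) (λ a∥x → none (x , a∥x))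

  -- If some x ≠ b is incomparable to a, then b lies below everything but a: a counterexample y
  -- would make placeBelow R a x a proper refinement with the same chain covers.
  two-minimal⇒superminimal : ∀ {a b} → Minimal R a → Minimal R b → a ≢ b →
                             SuperminimalPair R a b ⊎ SuperminimalPair R b a
  two-minimal⇒superminimal {a} {b} a-min b-min a≢b
    with any? (λ x → ¬? (comparable? R a x) ×-dec ¬? (x ≟ b))
  ... | no none = inj₁ (record { z-minimal = a-min ; w-minimal = b-min ; z∥w = a∥b ; z-below = a-below })
    where
    a∥b = minimal-incomparable a-min b-min a≢b
    a-below : ∀ x → x ≢ b → T (R a x)
    a-below x x≢b with comparable? R a x
    ... | yes (inj₁ a⊑x) = a⊑x
    ... | yes (inj₂ x⊑a) = subst (λ t → T (R a t)) (sym (a-min x x⊑a)) (⊑-refl a)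
    ... | no a∥x        = ⊥-elim (none (x , a∥x , x≢b))
  ... | yes (x , a∥x , x≢b) =
    inj₂ (record { z-minimal = b-min ; w-minimal = a-min ; z∥w = b∥a ; z-below = b-below })
    where
    a∥b = minimal-incomparable a-min b-min a≢b
    b∥a = a∥b ∘ swap
    above : ∀ t → T (R a t) ⊎ T (R b t)
    above = above-one-of-two-minimal col po a-min b-min a≢b
    b⊑x : T (R b x)
    b⊑x = [ (λ a⊑x → ⊥-elim (a∥x (inj₁ a⊑x))) , (λ b⊑x → b⊑x) ]′ (above x)
    b-below : ∀ y → y ≢ a → T (R b y)
    b-below y y≢a = decidable-stable (T? (R b y)) λ b⋢y →
      let a⊑y = [ (λ a⊑y → a⊑y) , (λ b⊑y → ⊥-elim (b⋢y b⊑y)) ]′ (above y)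
          R′  = placeBelow R a x
          c₁ , c₂ , col₁ , col₂ , ¬same = maximal R′ (placeBelow-proper R a x po a-min (a∥x ∘ inj₁))
          lower = placeBelow-colouring po b-min a∥b x≢b b⊑x a⊑y b⋢y y≢a
      in unique⇒¬several unique (c₁ , c₂ , lower col₁ , lower col₂ , ¬same)

superminimal-pair : ∀ {k} {R : BRel (suc (suc k))} → IsPO R → Is2ChainRel R →
                    Σ (Fin _) λ z → Σ (Fin _) λ w → SuperminimalPair R z w
superminimal-pair {R = R} po 2chain with minimal-below po zero
... | a , _ , a-min with has-incomparable po 2chain a (punchInᵢ≢i a zero)
... | x , a∥x with minimal-below po x
... | b , b⊑x , b-min =
  [ (λ ab → a , b , ab) , (λ ba → b , a , ba) ]′ (two-minimal⇒superminimal po 2chain a-min b-min a≢b)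
  where
  a≢b : a ≢ b
  a≢b refl = a∥x (inj₁ b⊑x)

module _ where
  open Iso

  Iso-refl : ∀ {n} {A B : BRel n} → (∀ x y → A x y ≡ B x y) → Iso A B
  Iso-refl A≡B = record
    { to = λ x → x ; from = λ x → x ; from-to = λ _ → refl ; to-from = λ _ → refl ; preserve = A≡B }

  Iso-sym : ∀ {n m} {A : BRel n} {B : BRel m} → Iso A B → Iso B A
  Iso-sym {B = B} f = record
    { to = from f ; from = to f ; from-to = to-from f ; to-from = from-to f
    ; preserve = λ u v → trans (cong₂ B (sym (to-from f u)) (sym (to-from f v)))
                               (sym (preserve f (from f u) (from f v))) }

  Iso-trans : ∀ {n m k} {A : BRel n} {B : BRel m} {C : BRel k} → Iso A B → Iso B C → Iso A C
  Iso-trans f g = record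
    { to = to g ∘ to f ; from = from f ∘ from g
    ; from-to = λ x → trans (cong (from f) (from-to g (to f x))) (from-to f x)
    ; to-from = λ z → trans (cong (to g) (to-from f (from g z))) (to-from g z)
    ; preserve = λ x y → trans (preserve f x y) (preserve g (to f x) (to f y)) }

  Iso-injective : ∀ {n m} {A : BRel n} {B : BRel m} (f : Iso A B) {x y} → to f x ≡ to f y → x ≡ y
  Iso-injective f {x} {y} fx≡fy = trans (sym (from-to f x)) (trans (cong (from f) fx≡fy) (from-to f y))

  Iso-size : ∀ {n m} {A : BRel n} {B : BRel m} → Iso A B → n ≡ m
  Iso-size f = ℕ.≤-antisym (injective⇒≤ (Iso-injective f)) (injective⇒≤ (Iso-injective (Iso-sym f)))

  Iso-from-fixed : ∀ {n m} {A : BRel n} {B : BRel m} (f : Iso A B) {x y} → to f x ≡ y → from f y ≡ x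
  Iso-from-fixed f {x} refl = from-to f x

  Iso-trans-to : ∀ {n m k} {A : BRel n} {B : BRel m} {C : BRel k} (f : Iso A B) (g : Iso B C) {x y z} →
                 to f x ≡ y → to g y ≡ z → to (Iso-trans f g) x ≡ z
  Iso-trans-to f g fx≡y gy≡z = trans (cong (to g) fx≡y) gy≡z

  Iso-minimal : ∀ {n m} {A : BRel n} {B : BRel m} (f : Iso A B) {w} → Minimal A w → Minimal B (to f w)
  Iso-minimal {A = A} f {w} w-min y y⊑fw = trans (sym (to-from f y)) (cong (to f) (w-min (from f y)
    (subst T (trans (preserve (Iso-sym f) y (to f w)) (cong (A (from f y)) (from-to f w))) y⊑fw)))

  colouring-along : ∀ {n m} {A : BRel n} {B : BRel m} (f : Iso A B) {c} →
                    ChainColouring B c → ChainColouring A (c ∘ to f)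
  colouring-along f col x y same =
    Sum.map (subst T (sym (preserve f x y))) (subst T (sym (preserve f y x))) (col (to f x) (to f y) same)

SameWay-resp : ∀ {n} {c c' d d' : Fin n → Bool} → c ≗ d → c' ≗ d' → SameWay c c' → SameWay d d'
SameWay-resp c≗d c'≗d' (inj₁ e) = inj₁ λ i → trans (sym (c'≗d' i)) (trans (e i) (c≗d i))
SameWay-resp c≗d c'≗d' (inj₂ e) = inj₂ λ i → trans (sym (c'≗d' i)) (trans (e i) (cong not (c≗d i)))

SameWay-∘ : ∀ {n m} {c c' : Fin n → Bool} (g : Fin m → Fin n) → SameWay c c' → SameWay (c ∘ g) (c' ∘ g)
SameWay-∘ g (inj₁ e) = inj₁ (e ∘ g)
SameWay-∘ g (inj₂ e) = inj₂ (e ∘ g)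

module _ {n m} {A : BRel n} {B : BRel m} (f : Iso A B) where
  open Iso f

  unique-along : UniqueTwoChainCover A → UniqueTwoChainCover B
  unique-along (c , col , unique) =
    c ∘ from , colouring-along (Iso-sym f) col ,
    λ c' col' → SameWay-resp (λ _ → refl) (cong c' ∘ to-from)
                  (SameWay-∘ from (unique (c' ∘ to) (colouring-along f col')))

  several-along : SeveralTwoChainCovers A → SeveralTwoChainCovers B
  several-along (c₁ , c₂ , col₁ , col₂ , ¬same) =
    c₁ ∘ from , c₂ ∘ from , colouring-along (Iso-sym f) col₁ , colouring-along (Iso-sym f) col₂ ,
    ¬same ∘ SameWay-resp (cong c₁ ∘ from-to) (cong c₂ ∘ from-to) ∘ SameWay-∘ to

  pullback : BRel m → BRel n
  pullback R′ x y = R′ (to x) (to y)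

  pullback-proper : ∀ {R′} → ProperRefinement B R′ → ProperRefinement A (pullback R′)
  pullback-proper {R′} (po′ , refines , a , b , a⊑′b , a⋢b) =
    mkIsPO (⊑-refl ∘ to) (λ p q → Iso-injective f (⊑-antisym p q)) ⊑-trans ,
    (λ x y x⊑y → refines (to x) (to y) (subst T (preserve x y) x⊑y)) ,
    from a , from b , subst T (sym (cong₂ R′ (to-from a) (to-from b))) a⊑′b ,
    a⋢b ∘ subst T (sym (Iso.preserve (Iso-sym f) a b))
    where open PartialOrder po′

  pullback-iso : ∀ R′ → Iso (pullback R′) R′
  pullback-iso R′ = record
    { to = to ; from = from ; from-to = from-to ; to-from = to-from ; preserve = λ _ _ → refl }

Is2Chain-along : ∀ {n m} {A : BRel n} {B : BRel m} → Iso A B → Is2ChainRel A → Is2ChainRel B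
Is2Chain-along f (unique , maximal) =
  unique-along f unique ,
  λ R′ proper → several-along (pullback-iso f R′) (maximal (pullback f R′) (pullback-proper f proper))

Iso-tail : ∀ {n m} {A : BRel (suc n)} {B : BRel (suc m)} (f : Iso A B) → Iso.to f zero ≡ zero →
  Σ (Iso (λ x y → A (suc x) (suc y)) (λ x y → B (suc x) (suc y))) λ g →
    ∀ x → suc (Iso.to g x) ≡ Iso.to f (suc x)
Iso-tail {n} {m} {B = B} f f0≡0 = g , suc-to′
  where
  open Iso f
  to-suc≢0 : ∀ x → zero ≢ to (suc x)
  to-suc≢0 x 0≡fx with Iso-injective f (trans f0≡0 0≡fx)
  ... | ()
  from-suc≢0 : ∀ y → zero ≢ from (suc y)
  from-suc≢0 y 0≡gy with Iso-injective (Iso-sym f) (trans (Iso-from-fixed f f0≡0) 0≡gy)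
  ... | ()
  to′ : Fin n → Fin m
  to′ x = punchOut (to-suc≢0 x)
  from′ : Fin m → Fin n
  from′ y = punchOut (from-suc≢0 y)
  suc-to′ : ∀ x → suc (to′ x) ≡ to (suc x)
  suc-to′ x = punchIn-punchOut (to-suc≢0 x)
  suc-from′ : ∀ y → suc (from′ y) ≡ from (suc y)
  suc-from′ y = punchIn-punchOut (from-suc≢0 y)
  g : Iso _ _
  g = record
    { to = to′ ; from = from′
    ; from-to = λ x → suc-injective
        (trans (suc-from′ (to′ x)) (trans (cong from (suc-to′ x)) (from-to (suc x))))
    ; to-from = λ y → suc-injective
        (trans (suc-to′ (from′ y)) (trans (cong to (suc-from′ y)) (to-from (suc y))))
    ; preserve = λ x y → trans (preserve (suc x) (suc y)) (sym (cong₂ B (suc-to′ x) (suc-to′ y))) }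

BelowAllButOne : ∀ {n} → BRel n → Fin n → Set
BelowAllButOne S x = ∃ λ u → ∀ y → y ≢ u → T (S x y)

BelowAllButOne-along : ∀ {n m} {A : BRel n} {B : BRel m} (f : Iso A B) {x} →
                       BelowAllButOne A x → BelowAllButOne B (Iso.to f x)
BelowAllButOne-along {B = B} f {x} (u , below) = to u , λ y y≢fu →
  subst T (trans (preserve x (from y)) (cong (B (to x)) (to-from y)))
    (below (from y) (λ fy≡u → y≢fu (trans (sym (to-from y)) (cong to fy≡u))))
  where open Iso f

-- Cones

cone : ∀ {k} → BRel k → Fin k → BRel (suc k)
cone S w zero    zero    = true
cone S w zero    (suc y) = not ⌊ y ≟ w ⌋
cone S w (suc x) zero    = false
cone S w (suc x) (suc y) = S x y

cone-isPO : ∀ {k} {S : BRel k} → IsPO S → ∀ {w} → Minimal S w → IsPO (cone S w)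
cone-isPO {S = S} po {w} w-min = mkIsPO refl′ antisym′ (λ {x} {y} {z} → trans′ {x} {y} {z})
  where
  open PartialOrder po
  refl′ : ∀ x → T (cone S w x x)
  refl′ zero    = _
  refl′ (suc x) = ⊑-refl x
  antisym′ : ∀ {x y} → T (cone S w x y) → T (cone S w y x) → x ≡ y
  antisym′ {zero}  {zero}  _   _   = refl
  antisym′ {suc x} {suc y} x⊑y y⊑x = cong suc (⊑-antisym x⊑y y⊑x)
  trans′ : ∀ {x y z} → T (cone S w x y) → T (cone S w y z) → T (cone S w x z)
  trans′ {zero}  {zero}  {z}     _   0⊑z = 0⊑z
  trans′ {zero}  {suc y} {suc z} 0⊑y y⊑z = fromWitnessFalse λ { refl → toWitnessFalse 0⊑y (w-min y y⊑z) }
  trans′ {suc x} {suc y} {suc z} x⊑y y⊑z = ⊑-trans x⊑y y⊑z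

cone-refines : ∀ {k} {S S′ : BRel k} {w} → (∀ x y → T (S x y) → T (S′ x y)) →
               ∀ x y → T (cone S w x y) → T (cone S′ w x y)
cone-refines refines zero    zero    = λ p → p
cone-refines refines zero    (suc y) = λ p → p
cone-refines refines (suc x) (suc y) = refines x y

cone-resp-Iso : ∀ {k l} {S : BRel k} {S′ : BRel l} (f : Iso S S′) {w w′} → Iso.to f w ≡ w′ →
                Iso (cone S w) (cone S′ w′)
cone-resp-Iso {S = S} {S′} f {w} refl = record
  { to = to′ ; from = from′ ; from-to = from-to′ ; to-from = to-from′ ; preserve = preserve′ }
  where
  open Iso f
  to′ : Fin _ → Fin _
  to′ zero    = zero
  to′ (suc x) = suc (to x)
  from′ : Fin _ → Fin _
  from′ zero    = zero
  from′ (suc y) = suc (from y)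
  from-to′ : ∀ x → from′ (to′ x) ≡ x
  from-to′ zero    = refl
  from-to′ (suc x) = cong suc (from-to x)
  to-from′ : ∀ y → to′ (from′ y) ≡ y
  to-from′ zero    = refl
  to-from′ (suc y) = cong suc (to-from y)
  preserve′ : ∀ x y → cone S w x y ≡ cone S′ (to w) (to′ x) (to′ y)
  preserve′ zero    zero    = refl
  preserve′ zero    (suc y) = cong not (begin
    ⌊ y ≟ w ⌋          ≡⟨ isYes≗does (y ≟ w) ⟩
    does (y ≟ w)       ≡⟨ does-⇔ (mk⇔ (cong to) (Iso-injective f)) (y ≟ w) (to y ≟ to w) ⟩
    does (to y ≟ to w) ≡⟨ isYes≗does (to y ≟ to w) ⟨
    ⌊ to y ≟ to w ⌋    ∎)
    where open ≡-Reasoning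
  preserve′ (suc x) zero    = refl
  preserve′ (suc x) (suc y) = preserve x y

delete : ∀ {k} → BRel (suc k) → Fin (suc k) → BRel k
delete R z x y = R (punchIn z x) (punchIn z y)

delete-isPO : ∀ {k} {R : BRel (suc k)} → IsPO R → ∀ z → IsPO (delete R z)
delete-isPO po z = mkIsPO (⊑-refl ∘ punchIn z) (λ p q → punchIn-injective z _ _ (⊑-antisym p q)) ⊑-trans
  where open PartialOrder po

module _ {k} {R : BRel (suc k)} (po : IsPO R) {z w} (sm : SuperminimalPair R z w) where
  open PartialOrder po
  open SuperminimalPair sm

  z≢w : z ≢ w
  z≢w refl = z∥w (inj₁ (⊑-refl z))

  delete-minimal : Minimal (delete R z) (punchOut z≢w)
  delete-minimal y y⊑w′ = punchIn-injective z y _ (trans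
    (w-minimal _ (subst (λ t → T (R (punchIn z y) t)) (punchIn-punchOut z≢w) y⊑w′))
    (sym (punchIn-punchOut z≢w)))

  cone-delete : Iso R (cone (delete R z) (punchOut z≢w))
  cone-delete = record { to = to ; from = from ; from-to = from-to ; to-from = to-from ; preserve = preserve }
    where
    to : Fin (suc k) → Fin (suc k)
    to x with z ≟ x
    ... | yes _  = zero
    ... | no z≢x = suc (punchOut z≢x)
    from : Fin (suc k) → Fin (suc k)
    from zero    = z
    from (suc y) = punchIn z y
    from-to : ∀ x → from (to x) ≡ x
    from-to x with z ≟ x
    ... | yes z≡x = z≡x
    ... | no z≢x  = punchIn-punchOut z≢x
    to-from : ∀ y → to (from y) ≡ y
    to-from zero with z ≟ z
    ... | yes _  = refl
    ... | no z≢z = ⊥-elim (z≢z refl)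
    to-from (suc y) with z ≟ punchIn z y
    ... | yes z≡y = ⊥-elim (punchInᵢ≢i z y (sym z≡y))
    ... | no z≢y  = cong suc (trans (punchOut-cong z refl) (punchOut-punchIn z))
    preserve : ∀ x y → R x y ≡ cone (delete R z) (punchOut z≢w) (to x) (to y)
    preserve x y with z ≟ x | z ≟ y
    ... | yes refl | yes refl = T⇒≡true (⊑-refl z)
    ... | yes refl | no z≢y with y ≟ w
    ...   | yes refl = trans (¬T⇒≡false (z∥w ∘ inj₁))
                             (cong not (sym (T⇒≡true (fromWitness (punchOut-cong z refl)))))
    ...   | no y≢w   = trans (T⇒≡true (z-below y y≢w))
                             (cong not (sym (Equivalence.to T-not-≡ (fromWitnessFalse
                               (y≢w ∘ punchOut-injective z≢y z≢w)))))
    preserve x y | no z≢x | yes refl = ¬T⇒≡false (z≢x ∘ sym ∘ z-minimal x)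
    preserve x y | no z≢x | no z≢y   = sym (cong₂ R (punchIn-punchOut z≢x) (punchIn-punchOut z≢y))

cone-apex-incomparable : ∀ {k} (S : BRel k) w → Incomparable (cone S w) zero (suc w)
cone-apex-incomparable S w = [ (λ 0⊑w → toWitnessFalse 0⊑w refl) , (λ ()) ]′

colouring-below-apex : ∀ {k} {S : BRel k} {w c} → ChainColouring (cone S w) c → ChainColouring S (c ∘ suc)
colouring-below-apex col i j = col (suc i) (suc j)

SameWay-suc : ∀ {k} {c₁ c₂ : Fin (suc k) → Bool} w →
              c₁ zero ≡ not (c₁ (suc w)) → c₂ zero ≡ not (c₂ (suc w)) →
              SameWay (c₁ ∘ suc) (c₂ ∘ suc) → SameWay c₁ c₂
SameWay-suc {c₁ = c₁} {c₂} w e₁ e₂ (inj₁ same) = inj₁ λ where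
  zero    → trans e₂ (trans (cong not (same w)) (sym e₁))
  (suc i) → same i
SameWay-suc {c₁ = c₁} {c₂} w e₁ e₂ (inj₂ same) = inj₂ λ where
  zero    → trans e₂ (trans (cong not (same w)) (cong not (sym e₁)))
  (suc i) → same i

module _ {k} {D : BRel k} (po : IsPO D) {w} (w-min : Minimal D w) (2chain : Is2ChainRel (cone D w)) where
  private
    c = proj₁ (proj₁ 2chain)
    col = proj₁ (proj₂ (proj₁ 2chain))
    unique = proj₂ (proj₂ (proj₁ 2chain))
    maximal = proj₂ 2chain

    colᴰ : ChainColouring D (c ∘ suc)
    colᴰ = colouring-below-apex col

  -- The apex is comparable with everything except w, so it must take the colour opposite to w.
  uniqueness-below-apex : UniqueTwoChainCover D
  uniqueness-below-apex =
    c ∘ suc , colᴰ , λ c′ col′ → SameWay-∘ suc (unique (extend c′) (extend-colouring col′))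
    where
    extend : (Fin k → Bool) → Fin (suc k) → Bool
    extend c′ zero    = not (c′ w)
    extend c′ (suc i) = c′ i
    extend-colouring : ∀ {c′} → ChainColouring D c′ → ChainColouring (cone D w) (extend c′)
    extend-colouring col′ zero    zero    _    = inj₁ _
    extend-colouring col′ zero    (suc j) same = inj₁ (fromWitnessFalse λ { refl → not-¬ refl (sym same) })
    extend-colouring col′ (suc i) zero    same = inj₂ (fromWitnessFalse λ { refl → not-¬ refl same })
    extend-colouring col′ (suc i) (suc j) same = col′ i j same

  -- If w is not R′-minimal, the D-minimal element m below some y ≺′ w is R′-comparable to
  -- everything, and recolouring m gives a second cover; otherwise cone R′ w properly refines
  -- cone D w, and its two inequivalent covers restrict to R′.
  maximality-below-apex : ∀ R′ → ProperRefinement D R′ → SeveralTwoChainCovers R′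
  maximality-below-apex R′ (po′ , refines , a , b , a⊑′b , a⋢b)
    with any? (λ y → T? (R′ y w) ×-dec ¬? (y ≟ w))
  ... | yes (y , y⊑′w , y≢w) with minimal-below po y
  ...   | m , m⊑y , m-min =
    comparable-to-all⇒several po′ (refinement-colouring refines colᴰ) m~all w≢m
    where
    open PartialOrder po′
    w≢m : w ≢ m
    w≢m refl = y≢w (sym (⊑-antisym (refines _ _ m⊑y) y⊑′w))
    m~all : ∀ t → Comparable R′ m t
    m~all t = inj₁ ([ refines m t , (λ w⊑t → ⊑-trans m⊑′y (⊑-trans y⊑′w (refines w t w⊑t))) ]′
                     (above-one-of-two-minimal colᴰ po m-min w-min (w≢m ∘ sym) t))
      where m⊑′y = refines m y m⊑y
  maximality-below-apex R′ (po′ , refines , a , b , a⊑′b , a⋢b) | no none =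
    let c₁ , c₂ , col₁ , col₂ , ¬same = maximal (cone R′ w) proper
    in c₁ ∘ suc , c₂ ∘ suc , colouring-below-apex col₁ , colouring-below-apex col₂ ,
       ¬same ∘ SameWay-suc w (apex col₁) (apex col₂)
    where
    w-min′ : Minimal R′ w
    w-min′ y y⊑′w = decidable-stable (y ≟ w) λ y≢w → none (y , y⊑′w , y≢w)
    proper : ProperRefinement (cone D w) (cone R′ w)
    proper = cone-isPO po′ w-min′ , cone-refines refines , suc a , suc b , a⊑′b , a⋢b
    apex : ∀ {c} → ChainColouring (cone R′ w) c → c zero ≡ not (c (suc w))
    apex col = colour-incomparable col (cone-apex-incomparable R′ w)

  Is2Chain-below-apex : Is2ChainRel D
  Is2Chain-below-apex = uniqueness-below-apex , maximality-below-apex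

ConeDecomposition : ∀ {k} → BRel (suc k) → Set
ConeDecomposition {k} R = Σ (BRel k) λ D → Σ (Fin k) λ w →
  IsPO D × Minimal D w × Is2ChainRel D × Iso R (cone D w)

2chain-as-cone : ∀ {k} {R : BRel (suc (suc k))} → IsPO R → Is2ChainRel R → ConeDecomposition R
2chain-as-cone {k} {R} po 2chain = as-cone (superminimal-pair po 2chain)
  where
  as-cone : (Σ (Fin _) λ z → Σ (Fin _) λ w → SuperminimalPair R z w) → ConeDecomposition R
  as-cone (z , w , sm) =
    delete R z , w′ , delete-isPO po z , delete-minimal po sm ,
    Is2Chain-below-apex (delete-isPO po z) (delete-minimal po sm)
      (Is2Chain-along (cone-delete po sm) 2chain) ,
    cone-delete po sm
    where
    w′ = punchOut (z≢w po sm)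

-- Splices of the Q(m)

Admissible : List⁺ ℕ → Set
Admissible ns = All (3 ≤_) (toList ns)

3≤3+ : ∀ a → 3 ≤ 3 + a
3≤3+ a = s≤s (s≤s (s≤s z≤n))

zero-below-splice : ∀ {m ms} → Admissible (m ∷ ms) → ∀ i → T (spliceQs m ms zero (suc (suc i)))
zero-below-splice {ms = []}     (s≤s (s≤s (s≤s z≤n)) ∷ _)              i = _
zero-below-splice {ms = _ ∷ _} (s≤s (s≤s (s≤s (z≤n {a}))) ∷ 3≤m ∷ hs) i with splitAt (suc a) i
... | inj₁ _ = _
... | inj₂ j = ∨-introˡ _ (zero-below-splice (3≤m ∷ hs) j)

module SpliceBottom (a : ℕ) where
  S : (ms : List ℕ) → BRel (2 + chainSize (3 + a) ms)
  S = spliceQs (3 + a)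

  S-0-0 : ∀ ms → S ms zero zero ≡ true
  S-0-0 []      = refl
  S-0-0 (_ ∷ _) = refl

  S-1-1 : ∀ ms → S ms (suc zero) (suc zero) ≡ true
  S-1-1 []      = refl
  S-1-1 (_ ∷ _) = refl

  S-0-1 : ∀ ms → S ms zero (suc zero) ≡ false
  S-0-1 []      = refl
  S-0-1 (_ ∷ _) = refl

  S-1-0 : ∀ ms → S ms (suc zero) zero ≡ false
  S-1-0 []      = refl
  S-1-0 (_ ∷ _) = refl

  S-above-0 : ∀ ms i → S ms (suc (suc i)) zero ≡ false
  S-above-0 []      i = refl
  S-above-0 (_ ∷ _) i with splitAt (suc a) i
  ... | inj₁ _ = refl
  ... | inj₂ _ = refl

  S-above-1 : ∀ ms i → S ms (suc (suc i)) (suc zero) ≡ false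
  S-above-1 []      i = refl
  S-above-1 (_ ∷ _) i with splitAt (suc a) i
  ... | inj₁ _ = refl
  ... | inj₂ _ = refl

splice-suc : ∀ a b (R : BRel (suc a)) (R₀ : BRel a) p₀ p₁ (S : BRel (2 + b)) →
  (∀ i j → R (suc i) (suc j) ≡ R₀ i j) →
  ∀ x y → splice (suc a) b R (suc p₀) (suc p₁) S (suc x) (suc y) ≡ splice a b R₀ p₀ p₁ S x y
splice-suc a b R R₀ p₀ p₁ S R≡R₀ x y with splitAt a x | splitAt a y
... | inj₁ i | inj₁ j = R≡R₀ i j
... | inj₂ i | inj₂ j = refl
... | inj₁ i | inj₂ j rewrite R≡R₀ i p₀ | R≡R₀ i p₁ = refl
... | inj₂ i | inj₁ j = refl

spliceQs-suc≅cone : ∀ a ms → All (3 ≤_) ms →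
  Σ (Iso (spliceQs (3 + a) ms) (cone (spliceQs (2 + a) ms) zero)) λ f →
    Iso.to f zero ≡ zero × Iso.to f (suc zero) ≡ suc zero
spliceQs-suc≅cone a [] _ = Iso-refl pointwise , refl , refl
  where
  pointwise : ∀ x y → spliceQs (3 + a) [] x y ≡ cone (spliceQs (2 + a) []) zero x y
  pointwise zero    zero          = refl
  pointwise zero    (suc zero)    = refl
  pointwise zero    (suc (suc y)) = refl
  pointwise (suc x) zero          = refl
  pointwise (suc x) (suc y)       = refl
spliceQs-suc≅cone a (m ∷ ms) hs = Iso-refl pointwise , refl , refl
  where
  pointwise : ∀ x y → spliceQs (3 + a) (m ∷ ms) x y ≡ cone (spliceQs (2 + a) (m ∷ ms)) zero x y
  pointwise zero    zero          = refl
  pointwise zero    (suc zero)    = refl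
  pointwise zero    (suc (suc y)) = T⇒≡true (zero-below-splice (3≤3+ a ∷ hs) y)
  pointwise (suc x) zero          with splitAt (suc (suc a)) x
  ... | inj₁ _ = refl
  ... | inj₂ _ = refl
  pointwise (suc x) (suc y)       = splice-suc _ _ _ _ _ _ (spliceQs m ms) (λ _ _ → refl) x y

swap₁₂ : ∀ {c} → Fin (3 + c) → Fin (3 + c)
swap₁₂ zero                = zero
swap₁₂ (suc zero)          = suc (suc zero)
swap₁₂ (suc (suc zero))    = suc zero
swap₁₂ (suc (suc (suc i))) = suc (suc (suc i))

swap₁₂-involutive : ∀ {c} (x : Fin (3 + c)) → swap₁₂ (swap₁₂ x) ≡ x
swap₁₂-involutive zero                = refl
swap₁₂-involutive (suc zero)          = refl
swap₁₂-involutive (suc (suc zero))    = refl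
swap₁₂-involutive (suc (suc (suc i))) = refl

-- The elements 1 and 2 of Q(3) are glued to 1 and 0 of S, and 0 of Q(3) lies below all but 1.
spliceQs-3∷≗cone : ∀ a ms → All (3 ≤_) ms →
  ∀ x y → spliceQs 3 (3 + a ∷ ms) x y ≡ cone (spliceQs (3 + a) ms) (suc zero) (swap₁₂ x) (swap₁₂ y)
spliceQs-3∷≗cone a ms hs = go
  where
  open SpliceBottom a
  go : ∀ x y → spliceQs 3 (3 + a ∷ ms) x y ≡ cone (S ms) (suc zero) (swap₁₂ x) (swap₁₂ y)
  go zero                zero                = refl
  go zero                (suc zero)          = refl
  go zero                (suc (suc zero))    = refl
  go zero                (suc (suc (suc j))) =
    trans (∨-identityʳ _) (T⇒≡true (zero-below-splice (3≤3+ a ∷ hs) j))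
  go (suc zero)          zero                = refl
  go (suc zero)          (suc zero)          = sym (S-1-1 ms)
  go (suc zero)          (suc (suc zero))    = sym (S-1-0 ms)
  go (suc zero)          (suc (suc (suc j))) = refl
  go (suc (suc zero))    zero                = refl
  go (suc (suc zero))    (suc zero)          = sym (S-0-1 ms)
  go (suc (suc zero))    (suc (suc zero))    = sym (S-0-0 ms)
  go (suc (suc zero))    (suc (suc (suc j))) = ∨-identityʳ _
  go (suc (suc (suc i))) zero                = refl
  go (suc (suc (suc i))) (suc zero)          = sym (S-above-1 ms i)
  go (suc (suc (suc i))) (suc (suc zero))    = sym (S-above-0 ms i)
  go (suc (suc (suc i))) (suc (suc (suc j))) = refl

corner : ∀ {n} → Bool → Fin (suc (suc n))
corner false = zero
corner true  = suc zero

splice-minimal : ∀ {ns} → Admissible ns → ∀ x → Minimal (SpliceOfQs ns) x → Σ Bool λ b → x ≡ corner b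
splice-minimal _                                  zero          _     = false , refl
splice-minimal _                                  (suc zero)    _     = true , refl
splice-minimal (s≤s (s≤s (s≤s (z≤n {a}))) ∷ hs) (suc (suc i)) x-min
  with x-min zero (zero-below-splice (3≤3+ a ∷ hs) i)
... | ()

module _ {a : ℕ} {ms : List ℕ} (hs : All (3 ≤_) ms) where
  open SpliceBottom a

  splice-zero-below-all-but-one : BelowAllButOne (S ms) zero
  splice-zero-below-all-but-one = suc zero , λ where
    zero          _   → subst T (sym (S-0-0 ms)) _
    (suc zero)    1≢1 → ⊥-elim (1≢1 refl)
    (suc (suc i)) _   → zero-below-splice (3≤3+ a ∷ hs) i

  splice-not-above-zero : ∀ y → ¬ T (S ms zero y) → y ≡ suc zero
  splice-not-above-zero zero          0⋢0 = ⊥-elim (0⋢0 (subst T (sym (S-0-0 ms)) _))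
  splice-not-above-zero (suc zero)    _   = refl
  splice-not-above-zero (suc (suc i)) 0⋢y = ⊥-elim (0⋢y (zero-below-splice (3≤3+ a ∷ hs) i))

  below-all-but-one⇒zero : ∀ x → BelowAllButOne (S ms) x → x ≡ zero
  below-all-but-one⇒zero zero          _               = refl
  below-all-but-one⇒zero (suc zero)    (zero , below)  = ⊥-elim (1⋢2 ms below)
    where
    1⋢2 : ∀ ms → ¬ (∀ y → y ≢ zero → T (S ms (suc zero) y))
    1⋢2 []      below = below (suc (suc zero)) (λ ())
    1⋢2 (_ ∷ _) below = below (suc (suc zero)) (λ ())
  below-all-but-one⇒zero (suc zero)    (suc _ , below) =
    ⊥-elim (≡false⇒¬T (S-1-0 ms) (below zero (λ ())))
  below-all-but-one⇒zero (suc (suc i)) (zero , below)  =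
    ⊥-elim (≡false⇒¬T (S-above-1 ms i) (below (suc zero) (λ ())))
  below-all-but-one⇒zero (suc (suc i)) (suc _ , below) =
    ⊥-elim (≡false⇒¬T (S-above-0 ms i) (below zero (λ ())))

splice-iso-fixes-bottom : ∀ {ns ns′} → Admissible ns → Admissible ns′ →
  (g : Iso (SpliceOfQs ns) (SpliceOfQs ns′)) → Iso.to g zero ≡ zero × Iso.to g (suc zero) ≡ suc zero
splice-iso-fixes-bottom {ns} {ns′} (s≤s (s≤s (s≤s (z≤n {a}))) ∷ hs) (s≤s (s≤s (s≤s (z≤n {a′}))) ∷ hs′) g =
  g0≡0 , splice-not-above-zero hs′ (to (suc zero)) g1-not-above-0
  where
  open Iso g
  g0≡0 : to zero ≡ zero
  g0≡0 = below-all-but-one⇒zero hs′ (to zero) (BelowAllButOne-along g (splice-zero-below-all-but-one hs))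
  g1-not-above-0 : ¬ T (SpliceOfQs ns′ zero (to (suc zero)))
  g1-not-above-0 = ≡false⇒¬T (begin
    SpliceOfQs ns′ zero (to (suc zero))      ≡⟨ cong (λ t → SpliceOfQs ns′ t (to (suc zero))) g0≡0 ⟨
    SpliceOfQs ns′ (to zero) (to (suc zero)) ≡⟨ preserve zero (suc zero) ⟨
    SpliceOfQs ns zero (suc zero)            ≡⟨ SpliceBottom.S-0-1 a (List⁺.tail ns) ⟩
    false                                    ∎)
    where open ≡-Reasoning

grow : Bool → List⁺ ℕ → List⁺ ℕ
grow false (m ∷ ms) = suc m ∷ ms
grow true  (m ∷ ms) = 3 ∷ m ∷ ms

grow-admissible : ∀ b {ns} → Admissible ns → Admissible (grow b ns)
grow-admissible false (3≤m ∷ hs) = ℕ.m≤n⇒m≤1+n 3≤m ∷ hs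
grow-admissible true  hs         = 3≤3+ 0 ∷ hs

data Tower : List⁺ ℕ → Set where
  Q₃    : Tower (3 ∷ [])
  grown : ∀ b {ns} → Tower ns → Tower (grow b ns)

Tower⇒Admissible : ∀ {ns} → Tower ns → Admissible ns
Tower⇒Admissible Q₃          = 3≤3+ 0 ∷ []
Tower⇒Admissible (grown b t) = grow-admissible b (Tower⇒Admissible t)

Admissible⇒Tower : ∀ {ns} → Admissible ns → Tower ns
Admissible⇒Tower (s≤s (s≤s (s≤s (z≤n {a}))) ∷ hs) = tower a _ hs
  where
  tower : ∀ a ms → All (3 ≤_) ms → Tower (3 + a ∷ ms)
  tower zero    []       []                                 = Q₃
  tower zero    (_ ∷ ms) (s≤s (s≤s (s≤s (z≤n {a′}))) ∷ hs) = grown true (tower a′ ms hs)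
  tower (suc a) ms       hs                                 = grown false (tower a ms hs)

Peeling : Bool → List⁺ ℕ → Set
Peeling b ns = Σ (Iso (SpliceOfQs (grow b ns)) (cone (SpliceOfQs ns) (corner b))) λ f →
  Iso.to f zero ≡ zero × Iso.to f (suc zero) ≡ suc (corner b)

grow-iso : ∀ b {ns} → Admissible ns → Peeling b ns
grow-iso false (s≤s (s≤s (s≤s (z≤n {a}))) ∷ hs) = spliceQs-suc≅cone (suc a) _ hs
grow-iso true  (s≤s (s≤s (s≤s (z≤n {a}))) ∷ hs) =
  record { to = swap₁₂ ; from = swap₁₂ ; from-to = swap₁₂-involutive ; to-from = swap₁₂-involutive
         ; preserve = spliceQs-3∷≗cone a _ hs } ,
  refl , refl

spliceSize : List⁺ ℕ → ℕ
spliceSize ns = 2 + chainSize (List⁺.head ns) (List⁺.tail ns)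

admissible-size : ∀ {ns} → Admissible ns → 3 ≤ spliceSize ns
admissible-size {_ ∷ []}    (s≤s (s≤s (s≤s z≤n)) ∷ _) = 3≤3+ _
admissible-size {_ ∷ _ ∷ _} (s≤s (s≤s (s≤s z≤n)) ∷ _) = 3≤3+ _

splice-size : ∀ {ns} → Admissible ns → sum (toList ns) + 2 ≡ spliceSize ns + 2 * length (toList ns)
splice-size {m ∷ ms} adm = trans (cong (_+ 2) (sym (chainSize-sum m ms adm))) (ℕ.+-comm _ 2)
  where
  chainSize-sum : ∀ m ms → Admissible (m ∷ ms) → chainSize m ms + 2 * length (m ∷ ms) ≡ sum (m ∷ ms)
  chainSize-sum m []        (3≤m ∷ _)  = trans (ℕ.m∸n+n≡m (ℕ.<⇒≤ 3≤m)) (sym (ℕ.+-identityʳ m))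
  chainSize-sum m (m′ ∷ ms) (3≤m ∷ hs) = begin
    (m ∸ 2) + C + 2 * suc L   ≡⟨ cong ((m ∸ 2) + C +_) (ℕ.*-suc 2 L) ⟩
    (m ∸ 2) + C + (2 + 2 * L) ≡⟨ +-interchange (m ∸ 2) C 2 (2 * L) ⟩
    (m ∸ 2) + 2 + (C + 2 * L) ≡⟨ cong₂ _+_ (ℕ.m∸n+n≡m (ℕ.<⇒≤ 3≤m)) (chainSize-sum m′ ms hs) ⟩
    m + sum (m′ ∷ ms)         ∎
    where
    open ≡-Reasoning
    C = chainSize m′ ms
    L = length (m′ ∷ ms)

-- Uniqueness

corner-determined : ∀ {n m} {A : BRel (suc (suc n))} {B : BRel (suc (suc m))} (h : Iso A B) →
  Iso.to h zero ≡ zero → ∀ b b′ → Iso.to h (corner b) ≡ corner b′ → b ≡ b′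
corner-determined h h0≡0 false false _    = refl
corner-determined h h0≡0 false true  h0≡1 with trans (sym h0≡0) h0≡1
... | ()
corner-determined h h0≡0 true  false h1≡0 with Iso-injective h (trans h1≡0 (sym h0≡0))
... | ()
corner-determined h h0≡0 true  true  _    = refl

grow-iso-cancel : ∀ {b b′ ns ns′} → Admissible ns → Admissible ns′ →
  Iso (SpliceOfQs (grow b ns)) (SpliceOfQs (grow b′ ns′)) → b ≡ b′ × Iso (SpliceOfQs ns) (SpliceOfQs ns′)
grow-iso-cancel {b} {b′} {ns} {ns′} adm adm′ g = cancel (grow-iso b adm) (grow-iso b′ adm′)
  where
  g-bottom = splice-iso-fixes-bottom (grow-admissible b adm) (grow-admissible b′ adm′) g
  cancel : Peeling b ns → Peeling b′ ns′ → b ≡ b′ × Iso (SpliceOfQs ns) (SpliceOfQs ns′)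
  cancel (f , f0≡0 , f1≡c) (f′ , f′0≡0 , f′1≡c′) = corner-determined h h0≡0 b b′ h-corner , h
    where
    k = Iso-trans (Iso-sym f) (Iso-trans g f′)
    k0≡0 : Iso.to k zero ≡ zero
    k0≡0 = Iso-trans-to (Iso-sym f) (Iso-trans g f′) (Iso-from-fixed f f0≡0)
             (Iso-trans-to g f′ (proj₁ g-bottom) f′0≡0)
    k-corner : Iso.to k (suc (corner b)) ≡ suc (corner b′)
    k-corner = Iso-trans-to (Iso-sym f) (Iso-trans g f′) (Iso-from-fixed f f1≡c)
                 (Iso-trans-to g f′ (proj₂ g-bottom) f′1≡c′)
    h = proj₁ (Iso-tail k k0≡0)
    h0≡0 = proj₁ (splice-iso-fixes-bottom adm adm′ h)
    h-corner : Iso.to h (corner b) ≡ corner b′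
    h-corner = suc-injective (trans (proj₂ (Iso-tail k k0≡0) (corner b)) k-corner)

Q₃≇grown : ∀ b {ns} → Admissible ns → ¬ Iso (SpliceOfQs (3 ∷ [])) (SpliceOfQs (grow b ns))
Q₃≇grown b adm f
  with subst (3 ≤_) (sym (ℕ.suc-injective (trans (Iso-size f) (Iso-size (proj₁ (grow-iso b adm))))))
             (admissible-size adm)
... | s≤s (s≤s ())

Tower-unique : ∀ {ns ns′} → Tower ns → Tower ns′ → Iso (SpliceOfQs ns) (SpliceOfQs ns′) → ns ≡ ns′
Tower-unique Q₃          Q₃            _ = refl
Tower-unique Q₃          (grown b′ t′) g = ⊥-elim (Q₃≇grown b′ (Tower⇒Admissible t′) g)
Tower-unique (grown b t) Q₃            g = ⊥-elim (Q₃≇grown b (Tower⇒Admissible t) (Iso-sym g))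
Tower-unique (grown b t) (grown b′ t′) g =
  let b≡b′ , h = grow-iso-cancel (Tower⇒Admissible t) (Tower⇒Admissible t′) g
  in cong₂ grow b≡b′ (Tower-unique t t′ h)

-- Existence

module _ {D : BRel 2} (po : IsPO D) (2chain : Is2ChainRel D) where
  open PartialOrder po

  two-element-2chain-antichain : Incomparable D zero (suc zero)
  two-element-2chain-antichain 0~1 =
    unique⇒¬several (proj₁ 2chain)
      (comparable-to-all⇒several po (proj₁ (proj₂ (proj₁ 2chain))) 0~all 1≢0)
    where
    0~all : ∀ x → Comparable D zero x
    0~all zero       = inj₁ (⊑-refl zero)
    0~all (suc zero) = 0~1
    1≢0 : suc zero ≢ zero
    1≢0 ()

  two-element-2chain-discrete : ∀ x y → D x y ≡ Qrel 2 x y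
  two-element-2chain-discrete zero       zero       = T⇒≡true (⊑-refl zero)
  two-element-2chain-discrete zero       (suc zero) = ¬T⇒≡false (two-element-2chain-antichain ∘ inj₁)
  two-element-2chain-discrete (suc zero) zero       = ¬T⇒≡false (two-element-2chain-antichain ∘ inj₂)
  two-element-2chain-discrete (suc zero) (suc zero) = T⇒≡true (⊑-refl (suc zero))

  two-element-2chain-iso : ∀ w → Σ (Iso D (Qrel 2)) λ f → Iso.to f w ≡ zero
  two-element-2chain-iso zero       = Iso-refl two-element-2chain-discrete , refl
  two-element-2chain-iso (suc zero) =
    record { to = opposite ; from = opposite ; from-to = opposite-involutive ; to-from = opposite-involutive
           ; preserve = λ x y → trans (two-element-2chain-discrete x y) (Qrel₂-opposite x y) } ,
    refl
    where
    Qrel₂-opposite : ∀ x y → Qrel 2 x y ≡ Qrel 2 (opposite x) (opposite y)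
    Qrel₂-opposite zero       zero       = refl
    Qrel₂-opposite zero       (suc zero) = refl
    Qrel₂-opposite (suc zero) zero       = refl
    Qrel₂-opposite (suc zero) (suc zero) = refl

decompose : ∀ k {R : BRel (3 + k)} → IsPO R → Is2ChainRel R →
  Σ (List⁺ ℕ) λ ns → Tower ns × Iso R (SpliceOfQs ns)

decompose-cone : ∀ k {R : BRel (3 + k)} → ConeDecomposition R →
  Σ (List⁺ ℕ) λ ns → Tower ns × Iso R (SpliceOfQs ns)
decompose-cone zero (_ , w , poᴰ , _ , 2chainᴰ , R≅cone) =
  3 ∷ [] , Q₃ ,
  Iso-trans R≅cone (Iso-trans (cone-resp-Iso D≅Q₂ w↦0) (Iso-sym (proj₁ (spliceQs-suc≅cone 0 [] []))))
  where
  D≅Q₂ = proj₁ (two-element-2chain-iso poᴰ 2chainᴰ w)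
  w↦0 = proj₂ (two-element-2chain-iso poᴰ 2chainᴰ w)
decompose-cone (suc k) {R} (D , w , poᴰ , w-min , 2chainᴰ , R≅cone) =
  grow-decomposition (decompose k poᴰ 2chainᴰ)
  where
  grow-decomposition : (Σ (List⁺ ℕ) λ ns → Tower ns × Iso D (SpliceOfQs ns)) →
                       Σ (List⁺ ℕ) λ ns → Tower ns × Iso R (SpliceOfQs ns)
  grow-decomposition (ns , t , D≅S) =
    let adm = Tower⇒Admissible t
        b , w↦corner = splice-minimal adm _ (Iso-minimal D≅S w-min)
    in grow b ns , grown b t ,
       Iso-trans R≅cone (Iso-trans (cone-resp-Iso D≅S w↦corner) (Iso-sym (proj₁ (grow-iso b adm))))

decompose k po 2chain = decompose-cone k (2chain-as-cone po 2chain)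

proposition5p5 : (n : ℕ) → (P : FinPoset n) → 3 ≤ n → Is2Chain P →
    Σ (List⁺ ℕ) λ ns → Decomposition P ns ×
      ((ns' : List⁺ ℕ) → Decomposition P ns' → ns' ≡ ns)
proposition5p5 n P (s≤s (s≤s (s≤s (z≤n {k})))) 2chain = ns , (admissible , size , P≅S) , unique
  where
  decomposition = decompose k (FinPoset.isPO P) 2chain
  ns = proj₁ decomposition
  tower = proj₁ (proj₂ decomposition)
  P≅S = proj₂ (proj₂ decomposition)
  admissible = Tower⇒Admissible tower
  size : sum (toList ns) + 2 ≡ n + 2 * length (toList ns)
  size = trans (splice-size admissible) (cong (_+ 2 * length (toList ns)) (sym (Iso-size P≅S)))
  unique : ∀ ns′ → Decomposition P ns′ → ns′ ≡ ns
  unique ns′ (admissible′ , _ , P≅S′) =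
    Tower-unique (Admissible⇒Tower admissible′) tower (Iso-trans (Iso-sym P≅S′) P≅S)
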